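{- Let $k\ge1$. If $x\in A_{2k}$ and $y\in B_{2k}^{(1)}$, then either $x=y$ or $|x-y|\ge F_{2k}$.
   Context: $F_i$ are the Fibonacci numbers ($F_0=0,F_1=1,F_{m+1}=F_m+F_{m-1}$). Zeckendorf representation: every positive integer is uniquely a sum of Fibonacci numbers $F_i$ with distinct indices $i\ge2$, no two consecutive; $A_k$ is the set of positive integers whose Zeckendorf representation has smallest index $k$. Chung–Graham representation: every nonnegative integer $n$ is uniquely $n=\sum_{j\ge1}c_jF_{2j}$ with $c_j\in\{0,1,2\}$ such that whenever $j<j'$ and $c_j=c_{j'}=2$ there is $j''$ with $j<j''<j'$ and $c_{j''}=0$. $B_{2k}$ is the set of positive integers whose Chung–Graham representation has $c_k\neq0$ and $c_j=0$ for all $j<k$; $B_{2k}^{(1)}$ (resp. $B_{2k}^{(2)}$) is the subset of $B_{2k}$ with $c_k=1$ (resp. $c_k=2$). -}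

module Defs where

open import Data.Nat using (ℕ; zero; suc; _+_; _*_; _≤_; _<_)
open import Data.List using (List; []; _∷_; map)
open import Data.Nat.ListAction using (sum)
open import Data.List.Relation.Unary.All using (All)
open import Data.Product using (Σ; _×_; ∃-syntax)
open import Relation.Binary.PropositionalEquality using (_≡_)

F : ℕ → ℕ
F zero = 0
F (suc zero) = 1
F (suc (suc m)) = F (suc m) + F m

-- Zeckendorf representations, given as the list of indices in increasing
-- order: every index ≥ 2, consecutive indices differ by at least 2.

data Gapped : ℕ → List ℕ → Set where
  g[] : ∀ {i} → Gapped i []
  g∷  : ∀ {i j js} → suc (suc i) ≤ j → Gapped j js → Gapped i (j ∷ js)

IsZeckendorf : ℕ → List ℕ → Set
IsZeckendorf k rest = (2 ≤ k) × Gapped k rest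

A : ℕ → ℕ → Set
A k x = (0 < x) × (∃[ rest ] (IsZeckendorf k rest × sum (map F (k ∷ rest)) ≡ x))

-- Chung–Graham representations: a finite list of digits cs, where the
-- j-th entry (j ≥ 1, counted from 1) is the coefficient c_j of F (2j);
-- coefficients beyond the list are 0.

coef : List ℕ → ℕ → ℕ
coef cs zero = 0
coef [] (suc j) = 0
coef (c ∷ cs) (suc zero) = c
coef (c ∷ cs) (suc (suc j)) = coef cs (suc j)

cgValueFrom : ℕ → List ℕ → ℕ
cgValueFrom j [] = 0
cgValueFrom j (c ∷ cs) = c * F (2 * j) + cgValueFrom (suc j) cs

cgValue : List ℕ → ℕ
cgValue cs = cgValueFrom 1 cs

IsChungGraham : List ℕ → Set
IsChungGraham cs =
  All (_≤ 2) cs ×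
  (∀ j j' → 1 ≤ j → j < j' → coef cs j ≡ 2 → coef cs j' ≡ 2 →
     ∃[ j'' ] (j < j'' × j'' < j' × coef cs j'' ≡ 0))

-- B^{(d)}_{2k}: positive integers whose Chung–Graham representation has
-- c_k = d and c_j = 0 for all 1 ≤ j < k
Bd : ℕ → ℕ → ℕ → Set
Bd d k y = (0 < y) × (∃[ cs ] (IsChungGraham cs × cgValue cs ≡ y ×
             coef cs k ≡ d × (∀ j → 1 ≤ j → j < k → coef cs j ≡ 0)))

B1 : ℕ → ℕ → Set
B1 k y = Bd 1 k y

-- Write p = 2k = q + 1. By F (q + 1 + r) = F (q + 1) F (r + 1) + F q F r, the parts of x and y
-- beyond F p are F p s + F q w and F p t + F q v, where s = Σ F (r + 1) and w = Σ F r over the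
-- Zeckendorf indices r + p of x (so r ≥ 2 and the r are gapped), and t, v are the same sums over
-- the Chung–Graham terms c F (2j + p) of y. By d'Ocagne's identity
-- F (r + 1) F n − F r F (n + 1) = (−1)^r F (n − r), at a large level n the error s F n − w F (n + 1)
-- is a signed gapped Fibonacci sum, so lies in [−F (n − 1), F (n − 1)], while t F n − v F (n + 1)
-- is a Chung–Graham sum read backwards (all its indices are even), so lies in [0, F n). Hence
-- (s, w) and (t, v) are comparable coordinatewise, and then x = y or |x − y| ≥ F p.
module Submission where

open import Defs
open import Data.Nat using (ℕ; _≤_; _*_; ∣_-_∣)
open import Data.Sum using (_⊎_)
open import Relation.Binary.PropositionalEquality using (_≡_)

open import Data.Bool using (Bool; true; false)
open import Data.Empty using (⊥-elim)
open import Data.List using (List; []; _∷_; map; replicate; _++_; length)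
open import Data.List.Extrema.Nat using (max; xs≤max)
open import Data.List.Relation.Unary.All as All using (All; []; _∷_)
open import Data.List.Relation.Unary.All.Properties using (++⁻ʳ)
open import Data.Nat
open import Data.Nat.ListAction using (sum)
open import Data.Nat.Properties
open import Data.Nat.Solver using (module +-*-Solver)
open import Data.Product using (Σ-syntax; ∃-syntax; _×_; _,_)
open import Data.Sum using (inj₁; inj₂)
open import Function using (_∘_)
open import Relation.Binary.Definitions using (tri<; tri≈; tri>)
open import Relation.Binary.PropositionalEquality
open import Relation.Nullary using (¬_; yes; no)

open +-*-Solver

F-≤-suc : ∀ n → F n ≤ F (suc n)
F-≤-suc zero    = z≤n
F-≤-suc (suc n) = m≤m+n (F (suc n)) (F n)

F-mono : ∀ {m n} → m ≤ n → F m ≤ F n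
F-mono {n = zero} z≤n = ≤-refl
F-mono {n = suc n} m≤1+n with m≤n⇒m<n∨m≡n m≤1+n
... | inj₁ m<1+n = ≤-trans (F-mono (≤-pred m<1+n)) (F-≤-suc n)
... | inj₂ refl  = ≤-refl

F-suc-pos : ∀ n → 0 < F (suc n)
F-suc-pos n = F-mono {1} {suc n} (s≤s z≤n)

F-+ : ∀ m n → F (suc (m + n)) ≡ F (suc m) * F (suc n) + F m * F n
F-+ zero          n = solve 2 (λ a b → a := con 1 :* a :+ con 0 :* b) refl (F (suc n)) (F n)
F-+ (suc zero)    n = solve 2 (λ a b → a :+ b := con 1 :* a :+ con 1 :* b) refl (F (suc n)) (F n)
F-+ (suc (suc m)) n = begin
  F (suc (suc (m + n))) + F (suc (m + n))
    ≡⟨ cong₂ _+_ (F-+ (suc m) n) (F-+ m n) ⟩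
  (F (suc (suc m)) * F (suc n) + F (suc m) * F n) + (F (suc m) * F (suc n) + F m * F n)
    ≡⟨ solve 5 (λ a b c u v → (a :* u :+ b :* v) :+ (b :* u :+ c :* v)
                           := (a :+ b) :* u :+ (b :+ c) :* v)
             refl (F (suc (suc m))) (F (suc m)) (F m) (F (suc n)) (F n) ⟩
  F (suc (suc (suc m))) * F (suc n) + F (suc (suc m)) * F n
    ∎
  where open ≡-Reasoning

-- (−1)^i m = ifEven i m − ifOdd i m, where one of the two is always 0.
mutual
  ifEven : ℕ → ℕ → ℕ
  ifEven zero    m = m
  ifEven (suc i) m = ifOdd i m

  ifOdd : ℕ → ℕ → ℕ
  ifOdd zero    m = 0
  ifOdd (suc i) m = ifEven i m

mutual
  ifEven-≤ : ∀ i m → ifEven i m ≤ m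
  ifEven-≤ zero    m = ≤-refl
  ifEven-≤ (suc i) m = ifOdd-≤ i m

  ifOdd-≤ : ∀ i m → ifOdd i m ≤ m
  ifOdd-≤ zero    m = z≤n
  ifOdd-≤ (suc i) m = ifEven-≤ i m

ifEven-double : ∀ j m → ifEven (2 * j) m ≡ m × ifOdd (2 * j) m ≡ 0
ifEven-double zero    m = refl , refl
ifEven-double (suc j) m =
  subst (λ n → ifEven n m ≡ m × ifOdd n m ≡ 0) (sym (*-suc 2 j)) (ifEven-double j m)

F-dOcagne : ∀ i d → F (suc i) * F (i + d) + ifOdd i (F d) ≡ F i * F (suc (i + d)) + ifEven i (F d)
F-dOcagne zero    d = solve 1 (λ a → con 1 :* a :+ con 0 := con 0 :+ a) refl (F d)
F-dOcagne (suc i) d = begin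
  (F (suc i) + F i) * F (suc (i + d)) + ifEven i (F d)
    ≡⟨ solve 4 (λ a b c e → (a :+ b) :* c :+ e := a :* c :+ (b :* c :+ e))
             refl (F (suc i)) (F i) (F (suc (i + d))) (ifEven i (F d)) ⟩
  F (suc i) * F (suc (i + d)) + (F i * F (suc (i + d)) + ifEven i (F d))
    ≡⟨ cong (F (suc i) * F (suc (i + d)) +_) (sym (F-dOcagne i d)) ⟩
  F (suc i) * F (suc (i + d)) + (F (suc i) * F (i + d) + ifOdd i (F d))
    ≡⟨ solve 4 (λ a c e o → a :* c :+ (a :* e :+ o) := a :* (c :+ e) :+ o)
             refl (F (suc i)) (F (suc (i + d))) (F (i + d)) (ifOdd i (F d)) ⟩
  F (suc i) * (F (suc (i + d)) + F (i + d)) + ifOdd i (F d)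
    ∎
  where open ≡-Reasoning

F-dOcagne-even : ∀ j d → F (suc (2 * j)) * F (2 * j + d) ≡ F (2 * j) * F (suc (2 * j + d)) + F d
F-dOcagne-even j d with ifEven-double j (F d)
... | even , odd = trans (sym (+-identityʳ _))
  (subst₂ (λ o e → F (suc (2 * j)) * F (2 * j + d) + o ≡ F (2 * j) * F (suc (2 * j + d)) + e)
          odd even (F-dOcagne (2 * j) d))

sum-map-mono : ∀ {A : Set} {f g : A → ℕ} → (∀ x → f x ≤ g x) → ∀ xs → sum (map f xs) ≤ sum (map g xs)
sum-map-mono f≤g []       = z≤n
sum-map-mono f≤g (x ∷ xs) = +-mono-≤ (f≤g x) (sum-map-mono f≤g xs)

∸-suc-< : ∀ {n i} → i < n → n ∸ i ≡ suc (n ∸ suc i)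
∸-suc-< {suc n} {zero}  _         = refl
∸-suc-< {suc n} {suc i} (s≤s i<n) = ∸-suc-< i<n

∸-gap : ∀ {n g i} → suc (suc g) ≤ i → i < n → suc (suc (n ∸ suc i)) ≤ n ∸ suc g
∸-gap {suc n} {zero}  {i}     2≤i       (s≤s i≤n) = begin
  2 + (n ∸ i)  ≡⟨ +-comm 2 (n ∸ i) ⟩
  (n ∸ i) + 2  ≤⟨ +-monoʳ-≤ (n ∸ i) 2≤i ⟩
  (n ∸ i) + i  ≡⟨ m∸n+n≡m i≤n ⟩
  n            ∎
  where open ≤-Reasoning
∸-gap {suc n} {suc g} {suc i} (s≤s 2+g≤i) (s≤s i<n) = ∸-gap 2+g≤i i<n

Comparable : ℕ → ℕ → ℕ → ℕ → Set
Comparable s w t v = (s ≡ t × w ≡ v) ⊎ (t < s × v ≤ w) ⊎ (s < t × w ≤ v)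

-- The hypotheses say s a − w (a + b) ∈ [−b, b] and t a − v (a + b) ∈ [0, a), so these two errors
-- differ by less than a + b; if w and v differed in a direction that s and t do not follow, they
-- would differ by at least a + b.
approximants-comparable : ∀ {a b s w t v N P C} →
  s * a + N ≡ w * (a + b) + P → N ≤ b → P ≤ b → t * a ≡ v * (a + b) + C → C < a →
  Comparable s w t v
approximants-comparable {a} {b} {s} {w} {t} {v} {N} {P} {C} eˣ N≤b P≤b eʸ C<a with <-cmp w v
... | tri≈ _ refl _ with <-cmp s t
...   | tri< s<t _ _  = inj₂ (inj₂ (s<t , ≤-refl))
...   | tri≈ _ refl _ = inj₁ (refl , refl)
...   | tri> _ _ t<s  = inj₂ (inj₁ (t<s , ≤-refl))
approximants-comparable {a} {b} {s} {w} {t} {v} {N} {P} {C} eˣ N≤b P≤b eʸ C<a | tri< w<v _ _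
  with s <? t
... | yes s<t = inj₂ (inj₂ (s<t , <⇒≤ w<v))
... | no s≮t  = ⊥-elim (<⇒≱ P<a+b (+-cancelˡ-≤ (w * (a + b)) _ _ chain))
  where
  P<a+b : P < a + b
  P<a+b = ≤-<-trans P≤b (m<n+m b (<-≤-trans z<s C<a))
  chain : w * (a + b) + (a + b) ≤ w * (a + b) + P
  chain = begin
    w * (a + b) + (a + b) ≡⟨ +-comm (w * (a + b)) (a + b) ⟩
    suc w * (a + b)       ≤⟨ *-monoˡ-≤ (a + b) w<v ⟩
    v * (a + b)           ≤⟨ m≤m+n (v * (a + b)) C ⟩
    v * (a + b) + C       ≡⟨ sym eʸ ⟩
    t * a                 ≤⟨ *-monoˡ-≤ a (≮⇒≥ s≮t) ⟩
    s * a                 ≤⟨ m≤m+n (s * a) N ⟩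
    s * a + N             ≡⟨ eˣ ⟩
    w * (a + b) + P       ∎
    where open ≤-Reasoning
approximants-comparable {a} {b} {s} {w} {t} {v} {N} {P} {C} eˣ N≤b P≤b eʸ C<a | tri> _ _ v<w
  with t <? s
... | yes t<s = inj₂ (inj₁ (t<s , <⇒≤ v<w))
... | no t≮s  = ⊥-elim (<⇒≱ (+-mono-<-≤ C<a N≤b) (+-cancelˡ-≤ (v * (a + b)) _ _ chain))
  where
  chain : v * (a + b) + (a + b) ≤ v * (a + b) + (C + N)
  chain = begin
    v * (a + b) + (a + b) ≡⟨ +-comm (v * (a + b)) (a + b) ⟩
    suc v * (a + b)       ≤⟨ *-monoˡ-≤ (a + b) v<w ⟩
    w * (a + b)           ≤⟨ m≤m+n (w * (a + b)) P ⟩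
    w * (a + b) + P       ≡⟨ sym eˣ ⟩
    s * a + N             ≤⟨ +-monoˡ-≤ N (*-monoˡ-≤ a (≮⇒≥ t≮s)) ⟩
    t * a + N             ≡⟨ cong (_+ N) eʸ ⟩
    v * (a + b) + C + N   ≡⟨ +-assoc (v * (a + b)) C N ⟩
    v * (a + b) + (C + N) ∎
    where open ≤-Reasoning

linear-gap : ∀ a b {s w t v} → t < s → v ≤ w → a * t + b * v + a ≤ a * s + b * w
linear-gap a b {s} {w} {t} {v} t<s v≤w = begin
  a * t + b * v + a
    ≡⟨ solve 4 (λ a b t v → a :* t :+ b :* v :+ a := a :* (con 1 :+ t) :+ b :* v) refl a b t v ⟩
  a * suc t + b * v
    ≤⟨ +-mono-≤ (*-monoʳ-≤ a t<s) (*-monoʳ-≤ b v≤w) ⟩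
  a * s + b * w
    ∎
  where open ≤-Reasoning

≤∣-∣ : ∀ {m n d} → m + d ≤ n → d ≤ ∣ n - m ∣
≤∣-∣ {m} {n} {d} m+d≤n = subst (d ≤_) (sym (m≤n⇒∣n-m∣≡n∸m (m+n≤o⇒m≤o m m+d≤n)))
                                    (m+n≤o⇒m≤o∸n d (subst (_≤ n) (+-comm m d) m+d≤n))

separated : ∀ a b c {s w t v} → Comparable s w t v →
  c + (a * s + b * w) ≡ c + (a * t + b * v) ⊎ a ≤ ∣ c + (a * s + b * w) - c + (a * t + b * v) ∣
separated a b c (inj₁ (refl , refl)) = inj₁ refl
separated a b c {s} {w} {t} {v} (inj₂ (inj₁ (t<s , v≤w))) =
  inj₂ (subst (a ≤_) (sym (∣m+n-m+o∣≡∣n-o∣ c _ _)) (≤∣-∣ (linear-gap a b t<s v≤w)))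
separated a b c {s} {w} {t} {v} (inj₂ (inj₂ (s<t , w≤v))) =
  inj₂ (subst (a ≤_) (sym (trans (∣m+n-m+o∣≡∣n-o∣ c _ _) (∣-∣-comm (a * s + b * w) _)))
              (≤∣-∣ (linear-gap a b s<t w≤v)))

Gapped-shift : ∀ p g {js} → Gapped (p + g) js → Σ[ rs ∈ List ℕ ] (Gapped g rs × js ≡ map (p +_) rs)
Gapped-shift p g g[] = [] , g[] , refl
Gapped-shift p g (g∷ {j = j} gap js-gapped)
  with m≤n⇒∃[o]m+o≡n {p} {j} (m+n≤o⇒m≤o p (≤-trans (n≤1+n _) (≤-trans (n≤1+n _) gap)))
... | r , refl with Gapped-shift p r js-gapped
...   | rs , rs-gapped , refl = r ∷ rs , g∷ 2+g≤r rs-gapped , refl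
  where
  2+g≤r : suc (suc g) ≤ r
  2+g≤r = +-cancelˡ-≤ p _ _
            (subst (_≤ p + r) (sym (trans (+-suc p (suc g)) (cong suc (+-suc p g)))) gap)

sum-F-shift : ∀ q rs → sum (map F (map (suc q +_) rs)) ≡
              F (suc q) * sum (map (F ∘ suc) rs) + F q * sum (map F rs)
sum-F-shift q []       = solve 2 (λ a b → con 0 := a :* con 0 :+ b :* con 0) refl (F (suc q)) (F q)
sum-F-shift q (r ∷ rs) = begin
  F (suc (q + r)) + sum (map F (map (suc q +_) rs))
    ≡⟨ cong₂ _+_ (F-+ q r) (sum-F-shift q rs) ⟩
  (F (suc q) * F (suc r) + F q * F r) + (F (suc q) * S₁ + F q * S₀)
    ≡⟨ solve 6 (λ a b u v x y → (a :* u :+ b :* v) :+ (a :* x :+ b :* y)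
                              := a :* (u :+ x) :+ b :* (v :+ y))
             refl (F (suc q)) (F q) (F (suc r)) (F r) S₁ S₀ ⟩
  F (suc q) * (F (suc r) + S₁) + F q * (F r + S₀)
    ∎
  where
  open ≡-Reasoning
  S₁ = sum (map (F ∘ suc) rs)
  S₀ = sum (map F rs)

sum-F-dOcagne : ∀ n rs → All (_≤ n) rs →
  sum (map (F ∘ suc) rs) * F n + sum (map (λ r → ifOdd r (F (n ∸ r))) rs) ≡
  sum (map F rs) * F (suc n) + sum (map (λ r → ifEven r (F (n ∸ r))) rs)
sum-F-dOcagne n []       []           = refl
sum-F-dOcagne n (r ∷ rs) (r≤n ∷ rs≤n) = begin
  (F (suc r) + S₁) * F n + (ifOdd r (F (n ∸ r)) + O)
    ≡⟨ solve 5 (λ u s f o o′ → (u :+ s) :* f :+ (o :+ o′) := (u :* f :+ o) :+ (s :* f :+ o′))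
             refl (F (suc r)) S₁ (F n) (ifOdd r (F (n ∸ r))) O ⟩
  (F (suc r) * F n + ifOdd r (F (n ∸ r))) + (S₁ * F n + O)
    ≡⟨ cong₂ _+_ head (sum-F-dOcagne n rs rs≤n) ⟩
  (F r * F (suc n) + ifEven r (F (n ∸ r))) + (S₀ * F (suc n) + E)
    ≡⟨ solve 5 (λ u s f e e′ → (u :* f :+ e) :+ (s :* f :+ e′) := (u :+ s) :* f :+ (e :+ e′))
             refl (F r) S₀ (F (suc n)) (ifEven r (F (n ∸ r))) E ⟩
  (F r + S₀) * F (suc n) + (ifEven r (F (n ∸ r)) + E)
    ∎
  where
  open ≡-Reasoning
  S₁ = sum (map (F ∘ suc) rs)
  S₀ = sum (map F rs)
  O = sum (map (λ r → ifOdd r (F (n ∸ r))) rs)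
  E = sum (map (λ r → ifEven r (F (n ∸ r))) rs)
  head : F (suc r) * F n + ifOdd r (F (n ∸ r)) ≡ F r * F (suc n) + ifEven r (F (n ∸ r))
  head = subst (λ m → F (suc r) * F m + ifOdd r (F (n ∸ r)) ≡ F r * F (suc m) + ifEven r (F (n ∸ r)))
               (m+[n∸m]≡n r≤n) (F-dOcagne r (n ∸ r))

mirror-bound : ∀ n g {rs} → Gapped g rs → All (_< n) rs → sum (map (λ r → F (n ∸ r)) rs) ≤ F (n ∸ suc g)
mirror-bound n g g[]                   []           = z≤n
mirror-bound n g (g∷ {j = i} {js = rs} gap rs-gapped) (i<n ∷ rs<n) = begin
  F (n ∸ i) + sum (map (λ r → F (n ∸ r)) rs)
    ≤⟨ +-monoʳ-≤ (F (n ∸ i)) (mirror-bound n i rs-gapped rs<n) ⟩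
  F (n ∸ i) + F (n ∸ suc i)
    ≡⟨ cong (λ m → F m + F (n ∸ suc i)) (∸-suc-< i<n) ⟩
  F (suc (suc (n ∸ suc i)))
    ≤⟨ F-mono (∸-gap gap i<n) ⟩
  F (n ∸ suc g)
    ∎
  where open ≤-Reasoning

zeckendorf-approximant : ∀ m {rs} → Gapped 0 rs → All (_≤ m) rs →
  ∃[ N ] ∃[ P ] (sum (map (F ∘ suc) rs) * F (suc m) + N ≡ sum (map F rs) * F (suc (suc m)) + P
                 × N ≤ F m × P ≤ F m)
zeckendorf-approximant m {rs} rs-gapped rs≤m =
  _ , _ , sum-F-dOcagne (suc m) rs (All.map m≤n⇒m≤1+n rs≤m) , mirror≤ ifOdd-≤ , mirror≤ ifEven-≤
  where
  mirror≤ : ∀ {f : ℕ → ℕ → ℕ} → (∀ i x → f i x ≤ x) → sum (map (λ r → f r (F (suc m ∸ r))) rs) ≤ F m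
  mirror≤ f≤ = ≤-trans (sum-map-mono (λ r → f≤ r _) rs)
                       (mirror-bound (suc m) 0 rs-gapped (All.map s≤s rs≤m))

A-decompose : ∀ {q x} → A (suc q) x →
  Σ[ rs ∈ List ℕ ] (Gapped 0 rs × x ≡ F (suc q) + sum (map F (map (suc q +_) rs)))
A-decompose {q} (_ , js , (_ , js-gapped) , refl)
  with Gapped-shift (suc q) 0 (subst (λ i → Gapped i js) (sym (+-identityʳ (suc q))) js-gapped)
... | rs , rs-gapped , refl = rs , rs-gapped , refl

cgShiftFrom : ℕ → List ℕ → ℕ
cgShiftFrom j []       = 0
cgShiftFrom j (c ∷ cs) = c * F (suc (2 * j)) + cgShiftFrom (suc j) cs

cgValueFrom-+ : ∀ k q → 2 * k ≡ suc q → ∀ j cs →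
  cgValueFrom (k + j) cs ≡ F (suc q) * cgShiftFrom j cs + F q * cgValueFrom j cs
cgValueFrom-+ k q 2k≡1+q j [] =
  solve 2 (λ a b → con 0 := a :* con 0 :+ b :* con 0) refl (F (suc q)) (F q)
cgValueFrom-+ k q 2k≡1+q j (c ∷ cs) = begin
  c * F (2 * (k + j)) + cgValueFrom (suc (k + j)) cs
    ≡⟨ cong₂ (λ i l → c * F i + cgValueFrom l cs) index (sym (+-suc k j)) ⟩
  c * F (suc (q + 2 * j)) + cgValueFrom (k + suc j) cs
    ≡⟨ cong₂ (λ u z → c * u + z) (F-+ q (2 * j)) (cgValueFrom-+ k q 2k≡1+q (suc j) cs) ⟩
  c * (F (suc q) * F (suc (2 * j)) + F q * F (2 * j)) + (F (suc q) * T + F q * V)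
    ≡⟨ solve 7 (λ c a b u v t w → c :* (a :* u :+ b :* v) :+ (a :* t :+ b :* w)
                                := a :* (c :* u :+ t) :+ b :* (c :* v :+ w))
             refl c (F (suc q)) (F q) (F (suc (2 * j))) (F (2 * j)) T V ⟩
  F (suc q) * (c * F (suc (2 * j)) + T) + F q * (c * F (2 * j) + V)
    ∎
  where
  open ≡-Reasoning
  T = cgShiftFrom (suc j) cs
  V = cgValueFrom (suc j) cs
  index : 2 * (k + j) ≡ suc (q + 2 * j)
  index = trans (*-distribˡ-+ 2 k j) (cong (_+ 2 * j) 2k≡1+q)

-- cgMirror h (c₀ ∷ c₁ ∷ …) = Σ_{i < h} cᵢ F (2 (h − i)): the digits reflected about position h.
cgMirror : ℕ → List ℕ → ℕ
cgMirror h       []       = 0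
cgMirror zero    (c ∷ cs) = 0
cgMirror (suc h) (c ∷ cs) = c * F (2 + 2 * h) + cgMirror h cs

cgValueFrom-dOcagne : ∀ j h cs → length cs ≤ h →
  cgShiftFrom j cs * F (2 * j + 2 * h) ≡ cgValueFrom j cs * F (suc (2 * j + 2 * h)) + cgMirror h cs
cgValueFrom-dOcagne j h       []       _           = refl
cgValueFrom-dOcagne j (suc h) (c ∷ cs) (s≤s len≤h) = begin
  (c * F (suc (2 * j)) + T) * F n
    ≡⟨ solve 4 (λ c a t x → (c :* a :+ t) :* x := c :* (a :* x) :+ t :* x)
             refl c (F (suc (2 * j))) T (F n) ⟩
  c * (F (suc (2 * j)) * F n) + T * F n
    ≡⟨ cong₂ (λ u z → c * u + z) head (subst (λ m → T * F m ≡ V * F (suc m) + M) (sym index) tail) ⟩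
  c * (F (2 * j) * F (suc n) + F (2 + 2 * h)) + (V * F (suc n) + M)
    ≡⟨ solve 6 (λ c b y e v m → c :* (b :* y :+ e) :+ (v :* y :+ m)
                              := (c :* b :+ v) :* y :+ (c :* e :+ m))
             refl c (F (2 * j)) (F (suc n)) (F (2 + 2 * h)) V M ⟩
  (c * F (2 * j) + V) * F (suc n) + (c * F (2 + 2 * h) + M)
    ∎
  where
  open ≡-Reasoning
  n = 2 * j + 2 * suc h
  T = cgShiftFrom (suc j) cs
  V = cgValueFrom (suc j) cs
  M = cgMirror h cs
  index : n ≡ 2 * suc j + 2 * h
  index = solve 2 (λ j h → con 2 :* j :+ con 2 :* (con 1 :+ h) := con 2 :* (con 1 :+ j) :+ con 2 :* h)
                refl j h
  head : F (suc (2 * j)) * F n ≡ F (2 * j) * F (suc n) + F (2 + 2 * h)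
  head = subst (λ m → F (suc (2 * j)) * F m ≡ F (2 * j) * F (suc m) + F (2 + 2 * h))
               (cong (2 * j +_) (sym (*-suc 2 h))) (F-dOcagne-even j (2 + 2 * h))
  tail : T * F (2 * suc j + 2 * h) ≡ V * F (suc (2 * suc j + 2 * h)) + M
  tail = cgValueFrom-dOcagne (suc j) h cs len≤h

-- Chung–Graham digit strings; the flag records whether a 2 has occurred since the last 0.
data CGWord : Bool → List ℕ → Set where
  []  : ∀ {b} → CGWord b []
  0∷_ : ∀ {b cs} → CGWord false cs → CGWord b (0 ∷ cs)
  1∷_ : ∀ {b cs} → CGWord b cs → CGWord b (1 ∷ cs)
  2∷_ : ∀ {cs} → CGWord true cs → CGWord false (2 ∷ cs)

mutual
  cgMirror-< : ∀ h {cs} → CGWord false cs → cgMirror h cs < F (2 + 2 * h)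
  cgMirror-< h       {[]}     _ = F-suc-pos (1 + 2 * h)
  cgMirror-< zero    {_ ∷ _}  _ = F-suc-pos 1
  cgMirror-< (suc h) {c ∷ cs} w = begin-strict
    c * X + cgMirror h cs <⟨ step w ⟩
    X + Y + X             ≡⟨ cong (λ n → F (2 + n)) (sym (*-suc 2 h)) ⟩
    F (2 + 2 * suc h)     ∎
    where
    open ≤-Reasoning
    X = F (2 + 2 * h)
    Y = F (1 + 2 * h)
    step : CGWord false (c ∷ cs) → c * X + cgMirror h cs < X + Y + X
    step (0∷ w) = <-≤-trans (cgMirror-< h w) (≤-trans (m≤m+n X Y) (m≤m+n (X + Y) X))
    step (1∷ w) = begin-strict
      1 * X + cgMirror h cs ≡⟨ cong (_+ cgMirror h cs) (*-identityˡ X) ⟩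
      X + cgMirror h cs     <⟨ +-monoʳ-< X (cgMirror-< h w) ⟩
      X + X                 ≤⟨ +-monoˡ-≤ X (m≤m+n X Y) ⟩
      X + Y + X             ∎
    step (2∷ w) = begin-strict
      2 * X + cgMirror h cs ≡⟨ solve 2 (λ x m → con 2 :* x :+ m := x :+ x :+ m) refl X (cgMirror h cs) ⟩
      X + X + cgMirror h cs <⟨ +-monoʳ-< (X + X) (cgMirror-<′ h w) ⟩
      X + X + Y             ≡⟨ solve 2 (λ x y → x :+ x :+ y := x :+ y :+ x) refl X Y ⟩
      X + Y + X             ∎

  cgMirror-<′ : ∀ h {cs} → CGWord true cs → cgMirror h cs < F (1 + 2 * h)
  cgMirror-<′ h       {[]}     _ = F-suc-pos (2 * h)
  cgMirror-<′ zero    {_ ∷ _}  _ = F-suc-pos 0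
  cgMirror-<′ (suc h) {c ∷ cs} w = begin-strict
    c * X + cgMirror h cs <⟨ step w ⟩
    X + Y                 ≡⟨ cong (λ n → F (1 + n)) (sym (*-suc 2 h)) ⟩
    F (1 + 2 * suc h)     ∎
    where
    open ≤-Reasoning
    X = F (2 + 2 * h)
    Y = F (1 + 2 * h)
    step : CGWord true (c ∷ cs) → c * X + cgMirror h cs < X + Y
    step (0∷ w) = <-≤-trans (cgMirror-< h w) (m≤m+n X Y)
    step (1∷ w) = begin-strict
      1 * X + cgMirror h cs ≡⟨ cong (_+ cgMirror h cs) (*-identityˡ X) ⟩
      X + cgMirror h cs     <⟨ +-monoʳ-< X (cgMirror-<′ h w) ⟩
      X + Y                 ∎

cg-approximant : ∀ h {ds} → CGWord false ds → length ds ≤ h →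
  ∃[ C ] (cgShiftFrom 1 ds * F (2 + 2 * h) ≡ cgValueFrom 1 ds * F (3 + 2 * h) + C × C < F (2 + 2 * h))
cg-approximant h {ds} w len≤h = _ , cgValueFrom-dOcagne 1 h ds len≤h , cgMirror-< h w

TwoSeparated : List ℕ → Set
TwoSeparated cs = ∀ j j' → 1 ≤ j → j < j' → coef cs j ≡ 2 → coef cs j' ≡ 2 →
                  ∃[ j'' ] (j < j'' × j'' < j' × coef cs j'' ≡ 0)

TwoSeparated-tail : ∀ {c cs} → TwoSeparated (c ∷ cs) → TwoSeparated cs
TwoSeparated-tail sep (suc j) (suc j') _ j<j' e e'
  with sep (suc (suc j)) (suc (suc j')) (s≤s z≤n) (s≤s j<j') e e'
... | suc (suc j'') , s≤s j<j'' , s≤s j''<j' , e₀ = suc j'' , j<j'' , j''<j' , e₀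

TwoSeparated-++⁻ʳ : ∀ xs {ys} → TwoSeparated (xs ++ ys) → TwoSeparated ys
TwoSeparated-++⁻ʳ []       sep = sep
TwoSeparated-++⁻ʳ (x ∷ xs) sep = TwoSeparated-++⁻ʳ xs (TwoSeparated-tail sep)

TwoSeparated-drop-1 : ∀ {c cs} → TwoSeparated (c ∷ 1 ∷ cs) → TwoSeparated (c ∷ cs)
TwoSeparated-drop-1 sep (suc zero) (suc zero) _ (s≤s ()) _ _
TwoSeparated-drop-1 sep (suc (suc j)) (suc zero) _ (s≤s ()) _ _
TwoSeparated-drop-1 sep (suc zero) (suc (suc j')) _ _ e e'
  with sep 1 (suc (suc (suc j'))) (s≤s z≤n) (s≤s (s≤s z≤n)) e e'
... | suc zero , s≤s () , _
... | suc (suc (suc j'')) , _ , s≤s j''<j' , e₀ = suc (suc j'') , s≤s (s≤s z≤n) , j''<j' , e₀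
TwoSeparated-drop-1 sep (suc (suc j)) (suc (suc j')) _ j<j' e e'
  with sep (suc (suc (suc j))) (suc (suc (suc j'))) (s≤s z≤n) (s≤s j<j') e e'
... | suc (suc (suc j'')) , s≤s j<j'' , s≤s j''<j' , e₀ = suc (suc j'') , j<j'' , j''<j' , e₀

¬TwoSeparated[2∷2∷] : ∀ {cs} → ¬ TwoSeparated (2 ∷ 2 ∷ cs)
¬TwoSeparated[2∷2∷] sep with sep 1 2 (s≤s z≤n) (s≤s (s≤s z≤n)) refl refl
... | suc (suc _) , _ , s≤s (s≤s () ) , _

mutual
  cgWord : ∀ {cs} → All (_≤ 2) cs → TwoSeparated cs → CGWord false cs
  cgWord {[]}     []          sep = []
  cgWord {0 ∷ cs} (_ ∷ cs≤2)  sep = 0∷ cgWord cs≤2 (TwoSeparated-tail sep)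
  cgWord {1 ∷ cs} (_ ∷ cs≤2)  sep = 1∷ cgWord cs≤2 (TwoSeparated-tail sep)
  cgWord {2 ∷ cs} (_ ∷ cs≤2)  sep = 2∷ cgWordAfter2 cs≤2 sep
  cgWord {suc (suc (suc _)) ∷ _} (s≤s (s≤s ()) ∷ _) _

  cgWordAfter2 : ∀ {cs} → All (_≤ 2) cs → TwoSeparated (2 ∷ cs) → CGWord true cs
  cgWordAfter2 {[]}     []         sep = []
  cgWordAfter2 {0 ∷ cs} (_ ∷ cs≤2) sep = 0∷ cgWord cs≤2 (TwoSeparated-tail (TwoSeparated-tail sep))
  cgWordAfter2 {1 ∷ cs} (_ ∷ cs≤2) sep = 1∷ cgWordAfter2 cs≤2 (TwoSeparated-drop-1 sep)
  cgWordAfter2 {2 ∷ cs} (_ ∷ cs≤2) sep = ⊥-elim (¬TwoSeparated[2∷2∷] sep)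
  cgWordAfter2 {suc (suc (suc _)) ∷ _} (s≤s (s≤s ()) ∷ _) _

cgValueFrom-replicate-0 : ∀ m j cs → cgValueFrom j (replicate m 0 ++ cs) ≡ cgValueFrom (m + j) cs
cgValueFrom-replicate-0 zero    j cs = refl
cgValueFrom-replicate-0 (suc m) j cs =
  trans (cgValueFrom-replicate-0 m (suc j) cs) (cong (λ i → cgValueFrom i cs) (+-suc m j))

leading-zeros : ∀ k cs → coef cs (suc k) ≡ 1 → (∀ j → 1 ≤ j → j < suc k → coef cs j ≡ 0) →
                Σ[ ds ∈ List ℕ ] (cs ≡ replicate k 0 ++ 1 ∷ ds)
leading-zeros zero    (c ∷ cs) c≡1 _     = cs , cong (_∷ cs) c≡1
leading-zeros (suc k) (c ∷ cs) ck≡1 zeros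
  with leading-zeros k cs ck≡1 (λ { (suc j) _ j<k → zeros (suc (suc j)) (s≤s z≤n) (s≤s j<k) })
... | ds , refl = ds , cong (_∷ _) (zeros 1 ≤-refl (s≤s (s≤s z≤n)))

B1-decompose : ∀ k {y} → B1 (suc k) y →
  Σ[ ds ∈ List ℕ ] (CGWord false ds × y ≡ F (2 * suc k) + cgValueFrom (suc k + 1) ds)
B1-decompose k (_ , cs , (cs≤2 , sep) , refl , ck≡1 , zeros) with leading-zeros k cs ck≡1 zeros
... | ds , refl = ds , word , value
  where
  word : CGWord false ds
  word with ++⁻ʳ (replicate k 0) cs≤2
  ... | _ ∷ ds≤2 = cgWord ds≤2 (TwoSeparated-tail (TwoSeparated-++⁻ʳ (replicate k 0) sep))
  value : cgValue (replicate k 0 ++ 1 ∷ ds) ≡ F (2 * suc k) + cgValueFrom (suc k + 1) ds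
  value = begin
    cgValueFrom 1 (replicate k 0 ++ 1 ∷ ds)            ≡⟨ cgValueFrom-replicate-0 k 1 (1 ∷ ds) ⟩
    1 * F (2 * (k + 1)) + cgValueFrom (suc k + 1) ds   ≡⟨ cong (_+ cgValueFrom (suc k + 1) ds) (*-identityˡ _) ⟩
    F (2 * (k + 1)) + cgValueFrom (suc k + 1) ds       ≡⟨ cong (λ i → F (2 * i) + cgValueFrom (suc k + 1) ds)
                                                               (+-comm k 1) ⟩
    F (2 * suc k) + cgValueFrom (suc k + 1) ds         ∎
    where open ≡-Reasoning

comparable-at-level : ∀ h {rs ds} → Gapped 0 rs → CGWord false ds →
  All (_≤ 1 + 2 * h) rs → length ds ≤ h →
  Comparable (sum (map (F ∘ suc) rs)) (sum (map F rs)) (cgShiftFrom 1 ds) (cgValueFrom 1 ds)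
comparable-at-level h rs-gapped ds-word rs≤ ds≤
  with zeckendorf-approximant (1 + 2 * h) rs-gapped rs≤ | cg-approximant h ds-word ds≤
... | N , P , eˣ , N≤ , P≤ | C , eʸ , C< = approximants-comparable eˣ N≤ P≤ eʸ C<

zeckendorf-cg-comparable : ∀ {rs ds} → Gapped 0 rs → CGWord false ds →
  Comparable (sum (map (F ∘ suc) rs)) (sum (map F rs)) (cgShiftFrom 1 ds) (cgValueFrom 1 ds)
zeckendorf-cg-comparable {rs} {ds} rs-gapped ds-word =
  comparable-at-level h rs-gapped ds-word
    (All.map (λ r≤max → ≤-trans r≤max max≤1+2h) (xs≤max 0 rs)) (m≤m+n (length ds) _)
  where
  h = length ds + max 0 rs
  max≤1+2h : max 0 rs ≤ 1 + 2 * h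
  max≤1+2h = ≤-trans (m≤n+m (max 0 rs) (length ds)) (m≤n⇒m≤1+n (m≤m+n h (1 * h)))

lemma15 : (k : ℕ) → 1 ≤ k → (x y : ℕ) → A (2 * k) x → B1 k y →
          x ≡ y ⊎ F (2 * k) ≤ ∣ x - y ∣
lemma15 (suc k) _ x y x∈A y∈B with A-decompose x∈A | B1-decompose k y∈B
... | rs , rs-gapped , refl | ds , ds-word , refl =
  subst₂ (λ X Y → F p + X ≡ F p + Y ⊎ F p ≤ ∣ F p + X - F p + Y ∣)
         (sym (sum-F-shift q rs)) (sym (cgValueFrom-+ (suc k) q refl 1 ds))
         (separated (F p) (F q) (F p) (zeckendorf-cg-comparable rs-gapped ds-word))
  where
  p = 2 * suc k
  q = pred p
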